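{- $g(K_n,K_5)\le n^{o(1)}$; that is, there is a function $\varepsilon(n)\to 0$ as $n\to\infty$ such that for every $n$ the edges of $K_n$ can be colored with at most $n^{\varepsilon(n)}$ colors so that every copy of $K_5$ in $K_n$ contains some color an odd number of times.
   Context: For graphs $G$ and $H$, $g(G,H)$ denotes the minimum number of colors in an edge-coloring of $G$ such that every copy of $H$ in $G$ has an odd color class, i.e. some color appears on an odd number of the edges of that copy. -}

module Defs where

open import Data.Nat using (ℕ; _%_; _^_; _≤_)
open import Data.Fin using (Fin; _<?_)
open import Data.Fin.Properties using (_≟_)
open import Data.List using (List; length; filter; cartesianProduct; allFin)
open import Data.Product using (_×_; _,_; proj₁; proj₂; ∃; ∃-syntax)
open import Function.Definitions using (Injective)
open import Relation.Binary.PropositionalEquality using (_≡_)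

-- An edge-colouring of K_n with (at most) m colours is a symmetric map
-- c : Fin n → Fin n → Fin m ; the colour of edge {i,j} (i ≠ j) is c i j.
-- Diagonal values are irrelevant (K_n has no loops).
Colouring : ℕ → ℕ → Set
Colouring n m = Fin n → Fin n → Fin m

Symmetric : ∀ {n m} → Colouring n m → Set
Symmetric {n} c = (i j : Fin n) → c i j ≡ c j i

edges5 : List (Fin 5 × Fin 5)
edges5 = filter (λ p → proj₁ p <? proj₂ p) (cartesianProduct (allFin 5) (allFin 5))

-- A copy of K_5 in K_n is given by an injective vertex map f : Fin 5 → Fin n.
-- Number of edges of that copy receiving colour x:
colourCount : ∀ {n m} → Colouring n m → (Fin 5 → Fin n) → Fin m → ℕ
colourCount c f x = length (filter (λ p → c (f (proj₁ p)) (f (proj₂ p)) ≟ x) edges5)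

HasOddColourClass : ∀ {n m} → Colouring n m → (Fin 5 → Fin n) → Set
HasOddColourClass {m = m} c f = ∃[ x ] (colourCount c f x % 2 ≡ 1)

K5Good : ∀ {n m} → Colouring n m → Set
K5Good {n} c = (f : Fin 5 → Fin n) → Injective _≡_ _≡_ f → HasOddColourClass c f

{-# OPTIONS --safe #-}
-- Points are words of length t over the alphabet Fin b, and the colour of a pair records the
-- first position where the two words differ, the two letters there, and the pattern (<, =, >)
-- of the letter comparisons after it; there are at most b² 3^t colours.  Among any five
-- distinct words some pair has a colour shared with no other pair of the five, so that colour
-- class is odd.  This goes by induction on t, grouping the words by their first letter.  Two
-- singleton groups give such a pair between them.  If all pairs inside groups lie in one group,
-- the induction hypothesis applies to the tails of that group (all words, or all but one).
-- Otherwise the groups have sizes 2 + 2 (+ 1) or 3 + 2: either a pair inside a group has a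
-- tail colour no other pair has, or the coincidences of tail colours single out a position at
-- which one pair across the two groups has a comparison pattern no other such pair has.
-- Taking b = 3^(2K) and t ≈ log_b n bounds the number of colours by n^(1/K).
module Submission where

open import Defs

open import Data.Nat using (ℕ; zero; suc; _+_; _*_; _^_; _≤_; _<_; _%_; s≤s; z≤n; NonZero)
import Data.Nat.Properties as ℕ
open import Data.Fin
  using (Fin; zero; suc; inject≤; punchIn; punchOut; combine; remQuot; _↑ˡ_; _↑ʳ_; splitAt)
open import Data.Fin.Properties
  using (<-cmp; <-irrefl; <-asym; _≟_; 0≢1+n; any?; all?; injective⇒≤; inject≤-injective;
         punchIn-injective; punchInᵢ≢i; punchIn-punchOut; combine-injective; combine-remQuot;
         splitAt-↑ˡ; splitAt-↑ʳ; ↑ˡ-injective; ↑ʳ-injective)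
open import Data.List using (length; filter)
open import Data.List.Properties using (filter-≐)
open import Data.Vec using (Vec; []; _∷_; lookup; map; zipWith; head; tail)
open import Data.Vec.Properties using (≡-dec; lookup-map; lookup-zipWith; ∷-injectiveˡ; ∷-injectiveʳ)
open import Data.Vec.Relation.Unary.All using (All; []; _∷_)
open import Data.Vec.Relation.Unary.AllPairs using ([]; _∷_)
open import Data.Vec.Relation.Unary.Unique.Propositional using (Unique)
open import Data.Vec.Relation.Unary.Unique.Propositional.Properties using (lookup-injective)
open import Data.Product using (_×_; _,_; proj₁; proj₂; ∃-syntax)
open import Data.Sum using (_⊎_; inj₁; inj₂; [_,_]′)
open import Data.Empty using (⊥-elim)
open import Function using (_∘′_; _∘_; id)
open import Function.Definitions using (Injective)
open import Relation.Nullary using (¬_; Dec; yes; no)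
open import Relation.Nullary.Decidable using (_×-dec_; _⊎-dec_; _→-dec_; ¬?; from-yes)
open import Relation.Binary using (tri<; tri≈; tri>; DecidableEquality)
open import Relation.Binary.PropositionalEquality
  using (_≡_; _≢_; refl; sym; trans; cong; cong₂; subst; subst₂; module ≡-Reasoning)
open import Data.Nat.Solver using (module +-*-Solver)
open +-*-Solver using (solve; _:+_; _:*_; _:=_; con)

outside-unique : ∀ {k n} → k ≤ suc n → (xs : Vec (Fin k) n) → Unique xs →
                 ∀ {x y} → All (x ≢_) xs → All (y ≢_) xs → x ≡ y
outside-unique k≤1+n xs xs-unique {x} {y} x∉xs y∉xs with x ≟ y
... | yes x≡y = x≡y
... | no x≢y = ⊥-elim (ℕ.≤⇒≯ k≤1+n (injective⇒≤ {f = lookup (x ∷ y ∷ xs)}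
                 λ {i} {j} → lookup-injective ((x≢y ∷ x∉xs) ∷ y∉xs ∷ xs-unique) i j))

SameEdge : ∀ {k} → Fin k → Fin k → Fin k → Fin k → Set
SameEdge c d a b = (c ≡ a × d ≡ b) ⊎ (c ≡ b × d ≡ a)

data Sign : Set where
  lt eq gt : Sign

opposite : Sign → Sign
opposite lt = gt
opposite eq = eq
opposite gt = lt

opposite-≢ : ∀ {s} → s ≢ eq → opposite s ≢ s
opposite-≢ {lt} _ ()
opposite-≢ {eq} s≢eq _ = s≢eq refl
opposite-≢ {gt} _ ()

opposite-≢eq : ∀ {s} → s ≢ eq → opposite s ≢ eq
opposite-≢eq {lt} _ ()
opposite-≢eq {eq} s≢eq _ = s≢eq refl
opposite-≢eq {gt} _ ()

_≟ˢ_ : DecidableEquality Sign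
lt ≟ˢ lt = yes refl
lt ≟ˢ eq = no λ ()
lt ≟ˢ gt = no λ ()
eq ≟ˢ lt = no λ ()
eq ≟ˢ eq = yes refl
eq ≟ˢ gt = no λ ()
gt ≟ˢ lt = no λ ()
gt ≟ˢ eq = no λ ()
gt ≟ˢ gt = yes refl

UniqueEntry : ∀ {A B C : Set} {m n} → (A → B → C) → Vec A m → Vec B n → Set
UniqueEntry f xs ys = ∃[ i ] ∃[ j ] ∀ i′ j′ →
  f (lookup xs i′) (lookup ys j′) ≡ f (lookup xs i) (lookup ys j) → i′ ≡ i × j′ ≡ j

module _ {A B C : Set} {m n} {xs : Vec A m} {ys : Vec B n} where

  UniqueEntry-coarsen : ∀ {C′ : Set} {f : A → B → C} {f′ : A → B → C′} →
                        (∀ {x y x′ y′} → f x y ≡ f x′ y′ → f′ x y ≡ f′ x′ y′) →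
                        UniqueEntry f′ xs ys → UniqueEntry f xs ys
  UniqueEntry-coarsen f⇒f′ (i , j , unique) = i , j , λ i′ j′ e → unique i′ j′ (f⇒f′ e)

  UniqueEntry-map⁻ : ∀ {A′ B′ : Set} {f : A′ → B′ → C} {g : A → A′} {h : B → B′} →
                     UniqueEntry f (map g xs) (map h ys) → UniqueEntry (λ x y → f (g x) (h y)) xs ys
  UniqueEntry-map⁻ {f = f} {g} {h} (i , j , unique) = i , j , λ i′ j′ e →
    unique i′ j′ (trans (cong₂ f (lookup-map i′ g xs) (lookup-map j′ h ys))
                   (trans e (sym (cong₂ f (lookup-map i g xs) (lookup-map j h ys)))))

UniqueEntry-swapʳ : ∀ {A B C : Set} {m} {f : A → B → C} {xs : Vec A m} {y y′ : B} →
                    UniqueEntry f xs (y ∷ y′ ∷ []) → UniqueEntry f xs (y′ ∷ y ∷ [])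
UniqueEntry-swapʳ (i , zero , unique) = i , suc zero , λ where
  i′ zero e → proj₁ (unique i′ (suc zero) e) , ⊥-elim (0≢1+n (sym (proj₂ (unique i′ (suc zero) e))))
  i′ (suc zero) e → proj₁ (unique i′ zero e) , refl
UniqueEntry-swapʳ (i , suc zero , unique) = i , zero , λ where
  i′ zero e → proj₁ (unique i′ (suc zero) e) , refl
  i′ (suc zero) e → proj₁ (unique i′ zero e) , ⊥-elim (0≢1+n (proj₂ (unique i′ zero e)))

module Construction (b : ℕ) where

  Point : ℕ → Set
  Point = Vec (Fin b)

  cmp : Fin b → Fin b → Sign
  cmp x y with <-cmp x y
  ... | tri< _ _ _ = lt
  ... | tri≈ _ _ _ = eq
  ... | tri> _ _ _ = gt

  cmp-refl : ∀ x → cmp x x ≡ eq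
  cmp-refl x with <-cmp x x
  ... | tri< x<x _ _ = ⊥-elim (<-irrefl refl x<x)
  ... | tri≈ _ _ _ = refl
  ... | tri> _ _ x>x = ⊥-elim (<-irrefl refl x>x)

  cmp-≢eq : ∀ {x y} → x ≢ y → cmp x y ≢ eq
  cmp-≢eq {x} {y} x≢y with <-cmp x y
  ... | tri< _ _ _ = λ ()
  ... | tri≈ _ x≡y _ = ⊥-elim (x≢y x≡y)
  ... | tri> _ _ _ = λ ()

  cmp-swap : ∀ x y → cmp y x ≡ opposite (cmp x y)
  cmp-swap x y with <-cmp x y | <-cmp y x
  ... | tri< x<y _ _ | tri< y<x _ _ = ⊥-elim (<-asym x<y y<x)
  ... | tri< _ x≢y _ | tri≈ _ y≡x _ = ⊥-elim (x≢y (sym y≡x))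
  ... | tri< _ _ _   | tri> _ _ _   = refl
  ... | tri≈ _ x≡y _ | tri< _ y≢x _ = ⊥-elim (y≢x (sym x≡y))
  ... | tri≈ _ _ _   | tri≈ _ _ _   = refl
  ... | tri≈ _ x≡y _ | tri> _ y≢x _ = ⊥-elim (y≢x (sym x≡y))
  ... | tri> _ _ _   | tri< _ _ _   = refl
  ... | tri> _ x≢y _ | tri≈ _ y≡x _ = ⊥-elim (x≢y (sym y≡x))
  ... | tri> _ _ y<x | tri> _ _ x<y = ⊥-elim (<-asym x<y y<x)

  signs : ∀ {t} → Point t → Point t → Vec Sign t
  signs = zipWith cmp

  signs-swap : ∀ {t} (u v : Point t) → signs v u ≡ map opposite (signs u v)
  signs-swap [] [] = refl
  signs-swap (x ∷ u) (y ∷ v) = cong₂ _∷_ (cmp-swap x y) (signs-swap u v)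

  signs-swap-cong : ∀ {t} {u v u′ v′ : Point t} → signs u v ≡ signs u′ v′ → signs v u ≡ signs v′ u′
  signs-swap-cong {u = u} {v} {u′} {v′} e =
    trans (signs-swap u v) (trans (cong (map opposite) e) (sym (signs-swap u′ v′)))

  -- The number of 'there's is the first coordinate where the two points differ; 'here' stores
  -- the two values there in increasing order and the signs of the later coordinates, read from
  -- the point with the smaller value.
  data Colour : ℕ → Set where
    identical : Colour 0
    here      : ∀ {t} → Fin b → Fin b → Vec Sign t → Colour (suc t)
    there     : ∀ {t} → Colour t → Colour (suc t)

  colour : ∀ {t} → Point t → Point t → Colour t
  colour [] [] = identical
  colour (x ∷ u) (y ∷ v) with <-cmp x y
  ... | tri< _ _ _ = here x y (signs u v)
  ... | tri≈ _ _ _ = there (colour u v)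
  ... | tri> _ _ _ = here y x (signs v u)

  here-injective : ∀ {t x y x′ y′} {s s′ : Vec Sign t} →
                   here x y s ≡ here x′ y′ s′ → x ≡ x′ × y ≡ y′ × s ≡ s′
  here-injective refl = refl , refl , refl

  there-injective : ∀ {t} {c c′ : Colour t} → there c ≡ there c′ → c ≡ c′
  there-injective refl = refl

  here≢there : ∀ {t x y s} {c : Colour t} → here x y s ≢ there c
  here≢there ()

  _≟ᶜ_ : ∀ {t} → DecidableEquality (Colour t)
  identical ≟ᶜ identical = yes refl
  here x y s ≟ᶜ here x′ y′ s′ with x ≟ x′ | y ≟ y′ | ≡-dec _≟ˢ_ s s′
  ... | yes refl | yes refl | yes refl = yes refl
  ... | no x≢x′ | _ | _ = no (x≢x′ ∘′ proj₁ ∘′ here-injective)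
  ... | yes _ | no y≢y′ | _ = no (y≢y′ ∘′ proj₁ ∘′ proj₂ ∘′ here-injective)
  ... | yes _ | yes _ | no s≢s′ = no (s≢s′ ∘′ proj₂ ∘′ proj₂ ∘′ here-injective)
  here _ _ _ ≟ᶜ there _ = no here≢there
  there _ ≟ᶜ here _ _ _ = no (here≢there ∘′ sym)
  there c ≟ᶜ there c′ with c ≟ᶜ c′
  ... | yes refl = yes refl
  ... | no c≢c′ = no (c≢c′ ∘′ there-injective)

  colour-there : ∀ {t x y} {u v : Point t} → x ≡ y → colour (x ∷ u) (y ∷ v) ≡ there (colour u v)
  colour-there {x = x} {y} x≡y with <-cmp x y
  ... | tri< _ x≢y _ = ⊥-elim (x≢y x≡y)
  ... | tri≈ _ _ _ = refl
  ... | tri> _ x≢y _ = ⊥-elim (x≢y x≡y)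

  colour-sym : ∀ {t} (u v : Point t) → colour u v ≡ colour v u
  colour-sym [] [] = refl
  colour-sym (x ∷ u) (y ∷ v) with <-cmp x y | <-cmp y x
  ... | tri< x<y _ _ | tri< y<x _ _ = ⊥-elim (<-asym x<y y<x)
  ... | tri< _ x≢y _ | tri≈ _ y≡x _ = ⊥-elim (x≢y (sym y≡x))
  ... | tri< _ _ _   | tri> _ _ _   = refl
  ... | tri≈ _ x≡y _ | tri< _ y≢x _ = ⊥-elim (y≢x (sym x≡y))
  ... | tri≈ _ _ _   | tri≈ _ _ _   = cong there (colour-sym u v)
  ... | tri≈ _ x≡y _ | tri> _ y≢x _ = ⊥-elim (y≢x (sym x≡y))
  ... | tri> _ _ _   | tri< _ _ _   = refl
  ... | tri> _ x≢y _ | tri≈ _ y≡x _ = ⊥-elim (x≢y (sym y≡x))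
  ... | tri> _ _ y<x | tri> _ _ x<y = ⊥-elim (<-asym x<y y<x)

  SameSplit : ∀ {t} → Fin b → Fin b → Point t → Point t → Fin b → Fin b → Point t → Point t → Set
  SameSplit x y u v x′ y′ u′ v′ =
    (x ≡ x′ × y ≡ y′ × signs u v ≡ signs u′ v′) ⊎ (x ≡ y′ × y ≡ x′ × signs u v ≡ signs v′ u′)

  colour-here-≡ : ∀ {t x y x′ y′} {u v u′ v′ : Point t} → x ≢ y →
                  colour (x ∷ u) (y ∷ v) ≡ colour (x′ ∷ u′) (y′ ∷ v′) →
                  x′ ≢ y′ × SameSplit x y u v x′ y′ u′ v′
  colour-here-≡ {x = x} {y} {x′} {y′} x≢y e with <-cmp x y | <-cmp x′ y′
  ... | tri≈ _ x≡y _ | _            = ⊥-elim (x≢y x≡y)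
  ... | tri< _ _ _   | tri≈ _ _ _   = ⊥-elim (here≢there e)
  ... | tri> _ _ _   | tri≈ _ _ _   = ⊥-elim (here≢there e)
  ... | tri< _ _ _   | tri< _ x′≢y′ _ = let p , q , r = here-injective e in x′≢y′ , inj₁ (p , q , r)
  ... | tri< _ _ _   | tri> _ x′≢y′ _ = let p , q , r = here-injective e in x′≢y′ , inj₂ (p , q , r)
  ... | tri> _ _ _   | tri< _ x′≢y′ _ =
    let p , q , r = here-injective e in x′≢y′ , inj₂ (q , p , signs-swap-cong r)
  ... | tri> _ _ _   | tri> _ x′≢y′ _ =
    let p , q , r = here-injective e in x′≢y′ , inj₁ (q , p , signs-swap-cong r)

  same-split-ends : ∀ {t x y x′ y′} {u v u′ v′ : Point t} → SameSplit x y u v x′ y′ u′ v′ →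
                    (x ≡ x′ × y ≡ y′) ⊎ (x ≡ y′ × y ≡ x′)
  same-split-ends (inj₁ (p , q , _)) = inj₁ (p , q)
  same-split-ends (inj₂ (p , q , _)) = inj₂ (p , q)

  colour-there≢here : ∀ {t x y x′ y′} {u v u′ v′ : Point t} → x ≡ y → x′ ≢ y′ →
                      colour (x ∷ u) (y ∷ v) ≢ colour (x′ ∷ u′) (y′ ∷ v′)
  colour-there≢here x≡y x′≢y′ e = proj₁ (colour-here-≡ x′≢y′ (sym e)) x≡y

  colour-there-≡ : ∀ {t x y x′ y′} {u v u′ v′ : Point t} → x ≡ y → x′ ≡ y′ →
                   colour (x ∷ u) (y ∷ v) ≡ colour (x′ ∷ u′) (y′ ∷ v′) → colour u v ≡ colour u′ v′
  colour-there-≡ x≡y x′≡y′ e =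
    there-injective (trans (sym (colour-there x≡y)) (trans e (colour-there x′≡y′)))

  colour-self : ∀ {t} (u v w : Point t) → colour u u ≡ colour v w → v ≡ w
  colour-self [] [] [] _ = refl
  colour-self (x ∷ u) (y ∷ v) (z ∷ w) e with y ≟ z
  ... | no y≢z = ⊥-elim (colour-there≢here refl y≢z e)
  ... | yes y≡z = cong₂ _∷_ y≡z (colour-self u v w (colour-there-≡ refl y≡z e))

  there-≢ : ∀ {t x y x′ y′} {u v u′ v′ : Point t} → x ≡ y → x′ ≡ y′ →
            colour u v ≢ colour u′ v′ → colour (x ∷ u) (y ∷ v) ≢ colour (x′ ∷ u′) (y′ ∷ v′)
  there-≢ x≡y x′≡y′ c≢c′ = c≢c′ ∘′ colour-there-≡ x≡y x′≡y′

  SharedSplit : ∀ {t} → Point t → Point t → Point t → Point t → Set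
  SharedSplit u v w z = ∃[ j ] (lookup u j ≢ lookup v j ×
    ((lookup u j ≡ lookup w j × lookup v j ≡ lookup z j) ⊎ (lookup u j ≡ lookup z j × lookup v j ≡ lookup w j)))

  colour-≡⇒shared-split : ∀ {t} (u v w z : Point t) → u ≢ v → colour u v ≡ colour w z → SharedSplit u v w z
  colour-≡⇒shared-split [] [] [] [] u≢v _ = ⊥-elim (u≢v refl)
  colour-≡⇒shared-split (x ∷ u) (y ∷ v) (x′ ∷ w) (y′ ∷ z) xu≢yv e with x ≟ y
  ... | no x≢y = zero , x≢y , same-split-ends (proj₂ (colour-here-≡ x≢y e))
  ... | yes x≡y with x′ ≟ y′
  ...   | no x′≢y′ = ⊥-elim (colour-there≢here x≡y x′≢y′ e)
  ...   | yes x′≡y′ =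
    let j , d , s = colour-≡⇒shared-split u v w z (xu≢yv ∘′ cong₂ _∷_ x≡y)
                                                    (colour-there-≡ x≡y x′≡y′ e)
    in suc j , d , s

  Differs : ∀ {t} → Colour t → Colour t → Colour t → Set
  Differs c c₁ c₂ = c ≢ c₁ × c ≢ c₂

  triangle : ∀ {t} (u v w : Point t) → u ≢ v → u ≢ w → v ≢ w →
             Differs (colour u v) (colour u w) (colour v w) ⊎
             Differs (colour u w) (colour u v) (colour v w) ⊎
             Differs (colour v w) (colour u v) (colour u w)
  triangle [] [] [] u≢v _ _ = ⊥-elim (u≢v refl)
  triangle (x ∷ u) (y ∷ v) (z ∷ w) xu≢yv xu≢zw yv≢zw with x ≟ y | x ≟ z | y ≟ z
  ... | yes x≡y | yes x≡z | _ with y≡z ← trans (sym x≡y) x≡z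
    with triangle u v w (xu≢yv ∘′ cong₂ _∷_ x≡y) (xu≢zw ∘′ cong₂ _∷_ x≡z)
                        (yv≢zw ∘′ cong₂ _∷_ y≡z)
  ...   | inj₁ (d₁ , d₂)        = inj₁ (there-≢ x≡y x≡z d₁ , there-≢ x≡y y≡z d₂)
  ...   | inj₂ (inj₁ (d₁ , d₂)) = inj₂ (inj₁ (there-≢ x≡z x≡y d₁ , there-≢ x≡z y≡z d₂))
  ...   | inj₂ (inj₂ (d₁ , d₂)) = inj₂ (inj₂ (there-≢ y≡z x≡y d₁ , there-≢ y≡z x≡z d₂))
  triangle (x ∷ u) (y ∷ v) (z ∷ w) _ _ _ | yes x≡y | no x≢z | _ =
    inj₁ (colour-there≢here x≡y x≢z , colour-there≢here x≡y (λ y≡z → x≢z (trans x≡y y≡z)))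
  triangle (x ∷ u) (y ∷ v) (z ∷ w) _ _ _ | no x≢y | yes x≡z | _ =
    inj₂ (inj₁ ( colour-there≢here x≡z x≢y
               , colour-there≢here x≡z (λ y≡z → x≢y (trans x≡z (sym y≡z)))))
  triangle (x ∷ u) (y ∷ v) (z ∷ w) _ _ _ | no x≢y | no x≢z | yes y≡z =
    inj₂ (inj₂ (colour-there≢here y≡z x≢y , colour-there≢here y≡z x≢z))
  triangle (x ∷ u) (y ∷ v) (z ∷ w) _ _ _ | no x≢y | no x≢z | no y≢z = inj₁ (uv≢uw , uv≢vw)
    where
      uv≢uw : colour (x ∷ u) (y ∷ v) ≢ colour (x ∷ u) (z ∷ w)
      uv≢uw e with same-split-ends (proj₂ (colour-here-≡ x≢y e))
      ... | inj₁ (_ , y≡z) = y≢z y≡z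
      ... | inj₂ (x≡z , _) = x≢z x≡z
      uv≢vw : colour (x ∷ u) (y ∷ v) ≢ colour (y ∷ v) (z ∷ w)
      uv≢vw e with same-split-ends (proj₂ (colour-here-≡ x≢y e))
      ... | inj₁ (x≡y , _) = x≢y x≡y
      ... | inj₂ (x≡z , _) = x≢z x≡z

  cmp-two-two : ∀ {A B} → A ≢ B → UniqueEntry cmp (A ∷ B ∷ []) (A ∷ B ∷ [])
  cmp-two-two {A} {B} A≢B = zero , suc zero , λ where
      zero zero e → ⊥-elim (s≢eq (trans (sym e) (cmp-refl A)))
      zero (suc zero) e → refl , refl
      (suc zero) zero e → ⊥-elim (opposite-≢ s≢eq (trans (sym (cmp-swap A B)) e))
      (suc zero) (suc zero) e → ⊥-elim (s≢eq (trans (sym e) (cmp-refl B)))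
    where s≢eq = cmp-≢eq A≢B

  -- Let s = cmp A B and let r be the common value of cmp C A and cmp C B.  The entry s is
  -- unique unless r ≡ s, and then the entry opposite s = cmp B A is.
  cmp-three-two : ∀ {A B C} → A ≢ B → cmp A C ≡ cmp B C →
                  UniqueEntry cmp (A ∷ B ∷ C ∷ []) (A ∷ B ∷ [])
  cmp-three-two {A} {B} {C} A≢B AC≡BC with opposite (cmp A C) ≟ˢ cmp A B
  ... | no r≢s = zero , suc zero , λ where
      zero zero e → ⊥-elim (s≢eq (trans (sym e) (cmp-refl A)))
      zero (suc zero) e → refl , refl
      (suc zero) zero e → ⊥-elim (opposite-≢ s≢eq (trans (sym (cmp-swap A B)) e))
      (suc zero) (suc zero) e → ⊥-elim (s≢eq (trans (sym e) (cmp-refl B)))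
      (suc (suc zero)) zero e → ⊥-elim (r≢s (trans (sym (cmp-swap A C)) e))
      (suc (suc zero)) (suc zero) e →
        ⊥-elim (r≢s (trans (cong opposite AC≡BC) (trans (sym (cmp-swap B C)) e)))
    where s≢eq = cmp-≢eq A≢B
  ... | yes r≡s = suc zero , zero , λ where
      zero zero e → ⊥-elim (s′≢eq (trans (sym BA≡s′) (trans (sym e) (cmp-refl A))))
      zero (suc zero) e → ⊥-elim (opposite-≢ s≢eq (sym (trans e BA≡s′)))
      (suc zero) zero e → refl , refl
      (suc zero) (suc zero) e → ⊥-elim (s′≢eq (trans (sym BA≡s′) (trans (sym e) (cmp-refl B))))
      (suc (suc zero)) zero e →
        ⊥-elim (opposite-≢ s≢eq (sym (trans (sym r≡s) (trans (sym (cmp-swap A C)) (trans e BA≡s′)))))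
      (suc (suc zero)) (suc zero) e →
        ⊥-elim (opposite-≢ s≢eq (sym (trans (sym r≡s) (trans (cong opposite AC≡BC)
                  (trans (sym (cmp-swap B C)) (trans e BA≡s′))))))
    where
      s≢eq = cmp-≢eq A≢B
      s′≢eq = opposite-≢eq s≢eq
      BA≡s′ = cmp-swap A B

  signs-≡⇒cmp-≡ : ∀ {t} (j : Fin t) {x y x′ y′ : Point t} → signs x y ≡ signs x′ y′ →
                  cmp (lookup x j) (lookup y j) ≡ cmp (lookup x′ j) (lookup y′ j)
  signs-≡⇒cmp-≡ j {x} {y} {x′} {y′} e =
    trans (sym (lookup-zipWith cmp j x y)) (trans (cong (λ s → lookup s j) e) (lookup-zipWith cmp j x′ y′))

  signs-at : ∀ {t m n} (j : Fin t) {xs : Vec (Point t) m} {ys : Vec (Point t) n} →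
             UniqueEntry cmp (map (λ p → lookup p j) xs) (map (λ p → lookup p j) ys) →
             UniqueEntry signs xs ys
  signs-at j {xs} {ys} u =
    UniqueEntry-coarsen {xs = xs} {ys} {f = signs} (signs-≡⇒cmp-≡ j)
                        (UniqueEntry-map⁻ {xs = xs} {ys} {f = cmp} u)

  signs-tail : ∀ {t m n} {xs : Vec (Point (suc t)) m} {ys : Vec (Point (suc t)) n} →
               UniqueEntry signs (map tail xs) (map tail ys) → UniqueEntry signs xs ys
  signs-tail {xs = xs} {ys} u =
    UniqueEntry-coarsen {xs = xs} {ys} {f = signs} tails (UniqueEntry-map⁻ {xs = xs} {ys} {f = signs} u)
    where
      tails : ∀ {t} {x y x′ y′ : Point (suc t)} → signs x y ≡ signs x′ y′ →
              signs (tail x) (tail y) ≡ signs (tail x′) (tail y′)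
      tails {x = _ ∷ _} {_ ∷ _} {_ ∷ _} {_ ∷ _} e = cong tail e

  signs-two-two : ∀ {t} (a b d e : Point t) (j : Fin t) →
                  lookup a j ≡ lookup d j → lookup b j ≡ lookup e j → lookup a j ≢ lookup b j →
                  UniqueEntry signs (a ∷ b ∷ []) (d ∷ e ∷ [])
  signs-two-two a b d e j a≡d b≡e a≢b = signs-at j {a ∷ b ∷ []} {d ∷ e ∷ []}
    (subst₂ (λ D E → UniqueEntry cmp (lookup a j ∷ lookup b j ∷ []) (D ∷ E ∷ [])) a≡d b≡e
            (cmp-two-two a≢b))

  signs-three-two : ∀ {t} (a b c d e : Point t) (j : Fin t) →
                    lookup a j ≡ lookup d j → lookup b j ≡ lookup e j → lookup a j ≢ lookup b j →
                    cmp (lookup a j) (lookup c j) ≡ cmp (lookup b j) (lookup c j) →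
                    UniqueEntry signs (a ∷ b ∷ c ∷ []) (d ∷ e ∷ [])
  signs-three-two a b c d e j a≡d b≡e a≢b ac≡bc = signs-at j {a ∷ b ∷ c ∷ []} {d ∷ e ∷ []}
    (subst₂ (λ D E → UniqueEntry cmp (lookup a j ∷ lookup b j ∷ lookup c j ∷ []) (D ∷ E ∷ [])) a≡d b≡e
            (cmp-three-two a≢b ac≡bc))

  three-two-signs : ∀ {t} (a b c d e : Point t) → a ≢ b →
                    colour a b ≡ colour d e → colour a c ≡ colour b c →
                    UniqueEntry signs (a ∷ b ∷ c ∷ []) (d ∷ e ∷ [])
  three-two-signs [] [] [] [] [] a≢b _ _ = ⊥-elim (a≢b refl)
  three-two-signs (x ∷ a) (y ∷ b) (z ∷ c) (w ∷ d) (v ∷ e) xa≢yb ab≡de ac≡bc with x ≟ y | z ≟ x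
  ... | no x≢y | yes z≡x =
    ⊥-elim (colour-there≢here (sym z≡x) (λ y≡z → x≢y (trans (sym z≡x) (sym y≡z))) ac≡bc)
  ... | no x≢y | no z≢x with same-split-ends (proj₂ (colour-here-≡ (z≢x ∘′ sym) ac≡bc))
  ...   | inj₁ (x≡y , _) = ⊥-elim (x≢y x≡y)
  ...   | inj₂ (x≡z , _) = ⊥-elim (z≢x (sym x≡z))
  three-two-signs (x ∷ a) (y ∷ b) (z ∷ c) (w ∷ d) (v ∷ e) xa≢yb ab≡de ac≡bc | yes x≡y | z≟x
    with w ≟ v
  ... | no w≢v = ⊥-elim (colour-there≢here x≡y w≢v ab≡de)
  ... | yes w≡v with z≟x
  ...   | yes z≡x = signs-tail {xs = (x ∷ a) ∷ (y ∷ b) ∷ (z ∷ c) ∷ []} {(w ∷ d) ∷ (v ∷ e) ∷ []}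
                       (three-two-signs a b c d e (xa≢yb ∘′ cong₂ _∷_ x≡y) (colour-there-≡ x≡y w≡v ab≡de)
                          (colour-there-≡ (sym z≡x) (trans (sym x≡y) (sym z≡x)) ac≡bc))
  ...   | no z≢x with colour-here-≡ (z≢x ∘′ sym) ac≡bc
  ...     | _ , inj₂ (x≡z , _) = ⊥-elim (z≢x (sym x≡z))
  ...     | _ , inj₁ (_ , _ , ac≡bc′)
    with colour-≡⇒shared-split a b d e (xa≢yb ∘′ cong₂ _∷_ x≡y) (colour-there-≡ x≡y w≡v ab≡de)
  ...       | j , a≢b , inj₁ (a≡d , b≡e) =
    signs-three-two (x ∷ a) (y ∷ b) (z ∷ c) (w ∷ d) (v ∷ e) (suc j) a≡d b≡e a≢b
                    (signs-≡⇒cmp-≡ j ac≡bc′)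
  ...       | j , a≢b , inj₂ (a≡e , b≡d) =
    UniqueEntry-swapʳ {f = signs} {(x ∷ a) ∷ (y ∷ b) ∷ (z ∷ c) ∷ []}
      (signs-three-two (x ∷ a) (y ∷ b) (z ∷ c) (v ∷ e) (w ∷ d) (suc j) a≡e b≡d a≢b
                       (signs-≡⇒cmp-≡ j ac≡bc′))

  UniquelyColoured : ∀ {k t} → (Fin k → Point t) → Fin k → Fin k → Set
  UniquelyColoured P a b =
    a ≢ b × (∀ c d → c ≢ d → colour (P c) (P d) ≡ colour (P a) (P b) → SameEdge c d a b)

  HasUniquelyColouredEdge : ∀ {k t} → (Fin k → Point t) → Set
  HasUniquelyColouredEdge P = ∃[ a ] ∃[ b ] UniquelyColoured P a b

  UniqueEdgeProperty : ℕ → ℕ → Set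
  UniqueEdgeProperty k t = (P : Fin k → Point t) → Injective _≡_ _≡_ P → HasUniquelyColouredEdge P

  SameEdge-colour : ∀ {k t} (P : Fin k → Point t) {a b c d} → SameEdge c d a b →
                    colour (P c) (P d) ≡ colour (P a) (P b)
  SameEdge-colour P (inj₁ (refl , refl)) = refl
  SameEdge-colour P {a} {b} (inj₂ (refl , refl)) = colour-sym (P b) (P a)

  module Split {k t} (H : Fin k → Fin b) (T : Fin k → Point t)
               (injective : ∀ {c d} → H c ≡ H d → T c ≡ T d → c ≡ d) where

    Q : Fin k → Point (suc t)
    Q c = H c ∷ T c

    T-≢ : ∀ {c d} → c ≢ d → H c ≡ H d → T c ≢ T d
    T-≢ c≢d Hc≡Hd = c≢d ∘′ injective Hc≡Hd

    Lonely : Fin k → Set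
    Lonely c = ∀ d → H d ≡ H c → d ≡ c

    InnerPair : Fin k → Fin k → Set
    InnerPair c d = c ≢ d × H c ≡ H d

    record Block {m} (α : Fin b) (xs : Vec (Fin k) m) : Set where
      constructor block
      field
        inside : ∀ i → H (lookup xs i) ≡ α
        covers : ∀ c → H c ≡ α → ∃[ i ] lookup xs i ≡ c

    Block-reindex : ∀ {m n α} {xs : Vec (Fin k) m} {ys : Vec (Fin k) n} →
                    (∀ i → ∃[ i′ ] lookup xs i′ ≡ lookup ys i) →
                    (∀ i → ∃[ i′ ] lookup ys i′ ≡ lookup xs i) →
                    Block α xs → Block α ys
    Block-reindex ys⊆xs xs⊆ys (block in-α covers) = block
      (λ i → let i′ , e = ys⊆xs i in trans (cong H (sym e)) (in-α i′))
      (λ c Hc≡α → let i , e = covers c Hc≡α ; i′ , e′ = xs⊆ys i in i′ , trans e′ e)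

    lonely-edge : ∀ {a b} → a ≢ b → Lonely a → Lonely b → UniquelyColoured Q a b
    lonely-edge {a} {b} a≢b a-lonely b-lonely = a≢b , λ c d _ e →
      [ (λ (Ha≡Hc , Hb≡Hd) → inj₁ (a-lonely c (sym Ha≡Hc) , b-lonely d (sym Hb≡Hd)))
      , (λ (Ha≡Hd , Hb≡Hc) → inj₂ (b-lonely c (sym Hb≡Hc) , a-lonely d (sym Ha≡Hd)))
      ]′ (same-split-ends (proj₂ (colour-here-≡ Ha≢Hb (sym e))))
      where Ha≢Hb = λ Ha≡Hb → a≢b (sym (a-lonely b (sym Ha≡Hb)))

    inner-edge : ∀ {a b} → InnerPair a b →
                 (∀ c d → InnerPair c d → colour (T c) (T d) ≡ colour (T a) (T b) → SameEdge c d a b) →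
                 UniquelyColoured Q a b
    inner-edge {a} {b} (a≢b , Ha≡Hb) unique = a≢b , only
      where
        only : ∀ c d → c ≢ d → colour (Q c) (Q d) ≡ colour (Q a) (Q b) → SameEdge c d a b
        only c d c≢d e with H c ≟ H d
        ... | yes Hc≡Hd = unique c d (c≢d , Hc≡Hd) (colour-there-≡ Hc≡Hd Ha≡Hb e)
        ... | no Hc≢Hd = ⊥-elim (colour-there≢here Ha≡Hb Hc≢Hd (sym e))

    cross-edge : ∀ {a b} → H a ≢ H b →
                 (∀ c d → H c ≡ H a → H d ≡ H b →
                    signs (T c) (T d) ≡ signs (T a) (T b) → c ≡ a × d ≡ b) →
                 UniquelyColoured Q a b
    cross-edge {a} {b} Ha≢Hb unique = Ha≢Hb ∘′ cong H , λ c d _ e →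
      [ (λ (Ha≡Hc , Hb≡Hd , s) → inj₁ (unique c d (sym Ha≡Hc) (sym Hb≡Hd) (sym s)))
      , (λ (Ha≡Hd , Hb≡Hc , s) →
           let d≡a , c≡b = unique d c (sym Ha≡Hd) (sym Hb≡Hc) (sym s) in inj₂ (c≡b , d≡a))
      ]′ (proj₂ (colour-here-≡ Ha≢Hb (sym e)))

    cross-edge-from-signs : ∀ {m n α β} {xs : Vec (Fin k) m} {ys : Vec (Fin k) n} → α ≢ β →
                            Block α xs → Block β ys → UniqueEntry signs (map T xs) (map T ys) →
                            HasUniquelyColouredEdge Q
    cross-edge-from-signs {xs = xs} {ys} α≢β (block xs-in-α covers-α) (block ys-in-β covers-β) unique
      with i , j , unique′ ← UniqueEntry-map⁻ {xs = xs} {ys} {f = signs} unique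
      = lookup xs i , lookup ys j , cross-edge Ha≢Hb only
      where
        Ha≢Hb = λ Ha≡Hb → α≢β (trans (sym (xs-in-α i)) (trans Ha≡Hb (ys-in-β j)))
        only : ∀ c d → H c ≡ H (lookup xs i) → H d ≡ H (lookup ys j) →
               signs (T c) (T d) ≡ signs (T (lookup xs i)) (T (lookup ys j)) →
               c ≡ lookup xs i × d ≡ lookup ys j
        only c d Hc Hd e with covers-α c (trans Hc (xs-in-α i)) | covers-β d (trans Hd (ys-in-β j))
        ... | i′ , refl | j′ , refl =
          let i′≡i , j′≡j = unique′ i′ j′ e in cong (lookup xs) i′≡i , cong (lookup ys) j′≡j

    block-edge : ∀ {k′} (emb : Fin k′ → Fin k) {α} → Injective _≡_ _≡_ emb →
                 (∀ i → H (emb i) ≡ α) → (∀ c → H c ≡ α → ∃[ i ] emb i ≡ c) →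
                 (∀ c d → InnerPair c d → H c ≡ α) → UniqueEdgeProperty k′ t → HasUniquelyColouredEdge Q
    block-edge emb emb-injective in-α covers inner-in-α unique-edge
      with a , b , a≢b , unique ← unique-edge (T ∘′ emb)
                                    (λ e → emb-injective (injective (trans (in-α _) (sym (in-α _))) e))
      = emb a , emb b , inner-edge (a≢b ∘′ emb-injective , same-block a b) only
      where
        same-block : ∀ i j → H (emb i) ≡ H (emb j)
        same-block i j = trans (in-α i) (sym (in-α j))
        only : ∀ c d → InnerPair c d → colour (T c) (T d) ≡ colour (T (emb a)) (T (emb b)) →
               SameEdge c d (emb a) (emb b)
        only c d cd@(_ , Hc≡Hd) e
          with covers c (inner-in-α c d cd) | covers d (trans (sym Hc≡Hd) (inner-in-α c d cd))
        ... | i , refl | j , refl with unique i j (proj₁ cd ∘′ cong emb) e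
        ...   | inj₁ (refl , refl) = inj₁ (refl , refl)
        ...   | inj₂ (refl , refl) = inj₂ (refl , refl)

    pair-block-edge : ∀ {α u v c d} → Block α (u ∷ v ∷ []) → InnerPair c d → H c ≡ α → SameEdge c d u v
    pair-block-edge {c = c} {d} (block in-α covers) (c≢d , Hc≡Hd) Hc≡α
      with covers c Hc≡α | covers d (trans (sym Hc≡Hd) Hc≡α)
    ... | zero , refl     | zero , refl     = ⊥-elim (c≢d refl)
    ... | zero , refl     | suc zero , refl = inj₁ (refl , refl)
    ... | suc zero , refl | zero , refl     = inj₂ (refl , refl)
    ... | suc zero , refl | suc zero , refl = ⊥-elim (c≢d refl)

    -- If the two pairs have different tail colours, the pair p q is uniquely coloured by its
    -- tail colour; otherwise a shared split of the tails makes one cross edge's signs unique.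
    two-pairs : ∀ {α β p q u v} → α ≢ β → p ≢ q → Block α (p ∷ q ∷ []) → Block β (u ∷ v ∷ []) →
                (∀ c d → InnerPair c d → H c ≡ α ⊎ H c ≡ β) → HasUniquelyColouredEdge Q
    two-pairs {p = p} {q} {u} {v} α≢β p≢q A@(block p,q-in-α _) B inner
      with colour (T p) (T q) ≟ᶜ colour (T u) (T v)
    ... | no pq≢uv = p , q , inner-edge (p≢q , Hp≡Hq) only
      where
        Hp≡Hq = trans (p,q-in-α zero) (sym (p,q-in-α (suc zero)))
        only : ∀ c d → InnerPair c d → colour (T c) (T d) ≡ colour (T p) (T q) → SameEdge c d p q
        only c d cd e with inner c d cd
        ... | inj₁ Hc≡α = pair-block-edge A cd Hc≡α
        ... | inj₂ Hc≡β = ⊥-elim (pq≢uv (trans (sym e) (SameEdge-colour T (pair-block-edge B cd Hc≡β))))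
    ... | yes pq≡uv
      with colour-≡⇒shared-split (T p) (T q) (T u) (T v)
             (T-≢ p≢q (trans (p,q-in-α zero) (sym (p,q-in-α (suc zero))))) pq≡uv
    ...   | j , n , inj₁ (pu , qv) =
      cross-edge-from-signs α≢β A B (signs-two-two (T p) (T q) (T u) (T v) j pu qv n)
    ...   | j , n , inj₂ (pv , qu) =
      cross-edge-from-signs α≢β A B (UniqueEntry-swapʳ {f = signs} {T p ∷ T q ∷ []}
                                      (signs-two-two (T p) (T q) (T v) (T u) j pv qu n))

    Block-swap₂₃ : ∀ {α x y z} → Block α (x ∷ y ∷ z ∷ []) → Block α (x ∷ z ∷ y ∷ [])
    Block-swap₂₃ = Block-reindex swap swap
      where
        swap : ∀ {A : Set} {a b c : A} i →
               ∃[ i′ ] lookup (a ∷ b ∷ c ∷ []) i′ ≡ lookup (a ∷ c ∷ b ∷ []) i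
        swap zero = zero , refl
        swap (suc zero) = suc (suc zero) , refl
        swap (suc (suc zero)) = suc zero , refl

    Block-rotate : ∀ {α x y z} → Block α (x ∷ y ∷ z ∷ []) → Block α (y ∷ z ∷ x ∷ [])
    Block-rotate = Block-reindex forward backward
      where
        forward : ∀ {A : Set} {a b c : A} i →
                  ∃[ i′ ] lookup (a ∷ b ∷ c ∷ []) i′ ≡ lookup (b ∷ c ∷ a ∷ []) i
        forward zero = suc zero , refl
        forward (suc zero) = suc (suc zero) , refl
        forward (suc (suc zero)) = zero , refl
        backward : ∀ {A : Set} {a b c : A} i →
                   ∃[ i′ ] lookup (b ∷ c ∷ a ∷ []) i′ ≡ lookup (a ∷ b ∷ c ∷ []) i
        backward zero = suc (suc zero) , refl
        backward (suc zero) = zero , refl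
        backward (suc (suc zero)) = suc zero , refl

    triangle-edge : ∀ {α x y z} → Block α (x ∷ y ∷ z ∷ []) → x ≢ y →
                    Differs (colour (T x) (T y)) (colour (T x) (T z)) (colour (T y) (T z)) →
                    (∀ c d → InnerPair c d → H c ≢ α → colour (T c) (T d) ≢ colour (T x) (T y)) →
                    UniquelyColoured Q x y
    triangle-edge {α} {x} {y} {z} (block in-α covers) x≢y (xy≢xz , xy≢yz) outside =
      inner-edge (x≢y , trans (in-α zero) (sym (in-α (suc zero)))) only
      where
        only : ∀ c d → InnerPair c d → colour (T c) (T d) ≡ colour (T x) (T y) → SameEdge c d x y
        only c d (c≢d , Hc≡Hd) e with H c ≟ α
        ... | no Hc≢α = ⊥-elim (outside c d (c≢d , Hc≡Hd) Hc≢α e)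
        ... | yes Hc≡α with covers c Hc≡α | covers d (trans (sym Hc≡Hd) Hc≡α)
        ...   | zero , refl           | zero , refl           = ⊥-elim (c≢d refl)
        ...   | zero , refl           | suc zero , refl       = inj₁ (refl , refl)
        ...   | zero , refl           | suc (suc zero) , refl = ⊥-elim (xy≢xz (sym e))
        ...   | suc zero , refl       | zero , refl           = inj₂ (refl , refl)
        ...   | suc zero , refl       | suc zero , refl       = ⊥-elim (c≢d refl)
        ...   | suc zero , refl       | suc (suc zero) , refl = ⊥-elim (xy≢yz (sym e))
        ...   | suc (suc zero) , refl | zero , refl           =
          ⊥-elim (xy≢xz (sym (trans (colour-sym (T x) (T z)) e)))
        ...   | suc (suc zero) , refl | suc zero , refl       =
          ⊥-elim (xy≢yz (sym (trans (colour-sym (T y) (T z)) e)))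
        ...   | suc (suc zero) , refl | suc (suc zero) , refl = ⊥-elim (c≢d refl)

    -- Tail colours: x y differs from x z and y z.  Either that colour is unique, or that of
    -- x z is, or both coincidences needed by three-two-signs hold and a cross edge is unique.
    three-two-ordered : ∀ {α β x y z u v} → α ≢ β → x ≢ y → x ≢ z →
                        Block α (x ∷ y ∷ z ∷ []) → Block β (u ∷ v ∷ []) →
                        (∀ c → H c ≡ α ⊎ H c ≡ β) →
                        Differs (colour (T x) (T y)) (colour (T x) (T z)) (colour (T y) (T z)) →
                        HasUniquelyColouredEdge Q
    three-two-ordered {α} {β} {x} {y} {z} {u} {v} α≢β x≢y x≢z A@(block x,y,z-in-α _) B all (xy≢xz , xy≢yz)
      with colour (T x) (T y) ≟ᶜ colour (T u) (T v)
    ... | no xy≢uv = x , y , triangle-edge A x≢y (xy≢xz , xy≢yz) outside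
      where
        outside : ∀ c d → InnerPair c d → H c ≢ α → colour (T c) (T d) ≢ colour (T x) (T y)
        outside c d cd Hc≢α e with all c
        ... | inj₁ Hc≡α = Hc≢α Hc≡α
        ... | inj₂ Hc≡β = xy≢uv (trans (sym e) (SameEdge-colour T (pair-block-edge B cd Hc≡β)))
    ... | yes xy≡uv with colour (T x) (T z) ≟ᶜ colour (T y) (T z)
    ...   | no xz≢yz = x , z , triangle-edge (Block-swap₂₃ A) x≢z
                                 (xy≢xz ∘′ sym , λ e → xz≢yz (trans e (colour-sym (T z) (T y)))) outside
      where
        outside : ∀ c d → InnerPair c d → H c ≢ α → colour (T c) (T d) ≢ colour (T x) (T z)
        outside c d cd Hc≢α e with all c
        ... | inj₁ Hc≡α = Hc≢α Hc≡α
        ... | inj₂ Hc≡β = xy≢xz (trans xy≡uv (trans (sym (SameEdge-colour T (pair-block-edge B cd Hc≡β))) e))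
    ...   | yes xz≡yz = cross-edge-from-signs α≢β A B
                          (three-two-signs (T x) (T y) (T z) (T u) (T v)
                             (T-≢ x≢y (trans (x,y,z-in-α zero) (sym (x,y,z-in-α (suc zero))))) xy≡uv xz≡yz)

    three-two : ∀ {α β x y z u v} → α ≢ β → x ≢ y → x ≢ z → y ≢ z →
                Block α (x ∷ y ∷ z ∷ []) → Block β (u ∷ v ∷ []) →
                (∀ c → H c ≡ α ⊎ H c ≡ β) → HasUniquelyColouredEdge Q
    three-two {x = x} {y} {z} α≢β x≢y x≢z y≢z A@(block in-α _) B all
      with triangle (T x) (T y) (T z) (T-≢ x≢y (Hx≡ (suc zero))) (T-≢ x≢z (Hx≡ (suc (suc zero))))
                    (T-≢ y≢z (trans (sym (Hx≡ (suc zero))) (Hx≡ (suc (suc zero)))))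
      where Hx≡ = λ i → trans (in-α zero) (sym (in-α i))
    ... | inj₁ d = three-two-ordered α≢β x≢y x≢z A B all d
    ... | inj₂ (inj₁ (d₁ , d₂)) = three-two-ordered α≢β x≢z x≢y (Block-swap₂₃ A) B all
                                    (d₁ , λ e → d₂ (trans e (colour-sym (T z) (T y))))
    ... | inj₂ (inj₂ (d₁ , d₂)) = three-two-ordered α≢β y≢z (x≢y ∘′ sym) (Block-rotate A) B all
                                    ((λ e → d₁ (trans e (colour-sym (T y) (T x))))
                                    , λ e → d₂ (trans e (colour-sym (T z) (T x))))

    ThirdOf : Fin k → Fin k → Fin k → Set
    ThirdOf p q x = H x ≡ H p × x ≢ p × x ≢ q

    third? : ∀ p q → Dec (∃[ x ] ThirdOf p q x)
    third? p q = any? λ x → (H x ≟ H p) ×-dec ¬? (x ≟ p) ×-dec ¬? (x ≟ q)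

    pair-block : ∀ {p q} → H p ≡ H q → (∀ x → ¬ ThirdOf p q x) → Block (H p) (p ∷ q ∷ [])
    pair-block {p} {q} Hp≡Hq no-third = block (λ { zero → refl ; (suc zero) → sym Hp≡Hq }) covers
      where
        covers : ∀ x → H x ≡ H p → ∃[ i ] lookup (p ∷ q ∷ []) i ≡ x
        covers x Hx≡Hp with x ≟ p | x ≟ q
        ... | yes refl | _        = zero , refl
        ... | no _     | yes refl = suc zero , refl
        ... | no x≢p   | no x≢q   = ⊥-elim (no-third x (Hx≡Hp , x≢p , x≢q))

    module TwoBlocks (k≤5 : k ≤ 5) {c d c′ d′ : Fin k} (c≢d : c ≢ d) (Hc≡Hd : H c ≡ H d)
                     (c′≢d′ : c′ ≢ d′) (Hc′≡Hd′ : H c′ ≡ H d′) (Hc≢Hc′ : H c ≢ H c′) where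

      across : ∀ {x y} → H x ≡ H c → H y ≡ H c′ → x ≢ y
      across Hx≡Hc Hy≡Hc′ x≡y = Hc≢Hc′ (trans (sym Hx≡Hc) (trans (cong H x≡y) Hy≡Hc′))

      four : Vec (Fin k) 4
      four = c ∷ d ∷ c′ ∷ d′ ∷ []

      outside-A : ∀ {x} → H x ≡ H c → x ≢ c → x ≢ d → All (x ≢_) four
      outside-A Hx≡Hc x≢c x≢d = x≢c ∷ x≢d ∷ across Hx≡Hc refl ∷ across Hx≡Hc (sym Hc′≡Hd′) ∷ []

      outside-B : ∀ {x} → H x ≡ H c′ → x ≢ c′ → x ≢ d′ → All (x ≢_) four
      outside-B Hx≡Hc′ x≢c′ x≢d′ =
        across refl Hx≡Hc′ ∘′ sym ∷ across (sym Hc≡Hd) Hx≡Hc′ ∘′ sym ∷ x≢c′ ∷ x≢d′ ∷ []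

      outside-by-H : ∀ {x} → H x ≢ H c → H x ≢ H c′ → All (x ≢_) four
      outside-by-H Hx≢Hc Hx≢Hc′ =
          Hx≢Hc ∘′ cong H ∷ (λ x≡d → Hx≢Hc (trans (cong H x≡d) (sym Hc≡Hd)))
        ∷ Hx≢Hc′ ∘′ cong H ∷ (λ x≡d′ → Hx≢Hc′ (trans (cong H x≡d′) (sym Hc′≡Hd′))) ∷ []

      -- This is where k ≤ 5 is needed: once four points are fixed, at most one point remains.
      at-most-one-outside : ∀ {x y} → All (x ≢_) four → All (y ≢_) four → x ≡ y
      at-most-one-outside = outside-unique k≤5 four
        ( (c≢d ∷ across refl refl ∷ across refl (sym Hc′≡Hd′) ∷ [])
        ∷ (across (sym Hc≡Hd) refl ∷ across (sym Hc≡Hd) (sym Hc′≡Hd′) ∷ [])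
        ∷ (c′≢d′ ∷ [])
        ∷ []
        ∷ [])

      three-two-with : ∀ {e} → ThirdOf c d e → HasUniquelyColouredEdge Q
      three-two-with {e} (He≡Hc , e≢c , e≢d) =
        three-two Hc≢Hc′ c≢d (e≢c ∘′ sym) (e≢d ∘′ sym) A (pair-block Hc′≡Hd′ no-third) all
        where
          only-e : ∀ {x} → All (x ≢_) four → x ≡ e
          only-e x-outside = at-most-one-outside x-outside (outside-A He≡Hc e≢c e≢d)
          covers : ∀ x → H x ≡ H c → ∃[ i ] lookup (c ∷ d ∷ e ∷ []) i ≡ x
          covers x Hx≡Hc with x ≟ c | x ≟ d
          ... | yes refl | _        = zero , refl
          ... | no _     | yes refl = suc zero , refl
          ... | no x≢c   | no x≢d   = suc (suc zero) , sym (only-e (outside-A Hx≡Hc x≢c x≢d))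
          A : Block (H c) (c ∷ d ∷ e ∷ [])
          A = block (λ { zero → refl ; (suc zero) → sym Hc≡Hd ; (suc (suc zero)) → He≡Hc }) covers
          no-third : ∀ x → ¬ ThirdOf c′ d′ x
          no-third x (Hx≡Hc′ , x≢c′ , x≢d′) =
            across He≡Hc Hx≡Hc′ (sym (only-e (outside-B Hx≡Hc′ x≢c′ x≢d′)))
          all : ∀ x → H x ≡ H c ⊎ H x ≡ H c′
          all x with H x ≟ H c | H x ≟ H c′
          ... | yes Hx≡Hc | _          = inj₁ Hx≡Hc
          ... | no _      | yes Hx≡Hc′ = inj₂ Hx≡Hc′
          ... | no Hx≢Hc  | no Hx≢Hc′  =
            ⊥-elim (Hx≢Hc (trans (cong H (only-e (outside-by-H Hx≢Hc Hx≢Hc′))) He≡Hc))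

      two-pairs-with : (∀ x → ¬ ThirdOf c d x) → (∀ x → ¬ ThirdOf c′ d′ x) → HasUniquelyColouredEdge Q
      two-pairs-with no-third no-third′ =
        two-pairs Hc≢Hc′ c≢d (pair-block Hc≡Hd no-third) (pair-block Hc′≡Hd′ no-third′) inner
        where
          inner : ∀ x y → InnerPair x y → H x ≡ H c ⊎ H x ≡ H c′
          inner x y (x≢y , Hx≡Hy) with H x ≟ H c | H x ≟ H c′
          ... | yes Hx≡Hc | _          = inj₁ Hx≡Hc
          ... | no _      | yes Hx≡Hc′ = inj₂ Hx≡Hc′
          ... | no Hx≢Hc  | no Hx≢Hc′  = ⊥-elim (x≢y (at-most-one-outside
                  (outside-by-H Hx≢Hc Hx≢Hc′)
                  (outside-by-H (Hx≢Hc ∘′ trans Hx≡Hy) (Hx≢Hc′ ∘′ trans Hx≡Hy))))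

    two-blocks : ∀ {c d c′ d′} → k ≤ 5 → InnerPair c d → InnerPair c′ d′ → H c ≢ H c′ →
                 HasUniquelyColouredEdge Q
    two-blocks {c} {d} {c′} {d′} k≤5 (c≢d , Hc≡Hd) (c′≢d′ , Hc′≡Hd′) Hc≢Hc′
      with third? c d | third? c′ d′
    ... | yes (_ , third) | _ =
      TwoBlocks.three-two-with k≤5 c≢d Hc≡Hd c′≢d′ Hc′≡Hd′ Hc≢Hc′ third
    ... | no _ | yes (_ , third) =
      TwoBlocks.three-two-with k≤5 c′≢d′ Hc′≡Hd′ c≢d Hc≡Hd (Hc≢Hc′ ∘′ sym) third
    ... | no ∄third | no ∄third′ =
      TwoBlocks.two-pairs-with k≤5 c≢d Hc≡Hd c′≢d′ Hc′≡Hd′ Hc≢Hc′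
        (λ x third → ∄third (x , third)) (λ x third → ∄third′ (x , third))

    lonely? : ∀ c → Dec (Lonely c)
    lonely? c = all? λ d → (H d ≟ H c) →-dec (d ≟ c)

    inner-pair? : ∀ c d → Dec (InnerPair c d)
    inner-pair? c d = ¬? (c ≟ d) ×-dec (H c ≟ H d)

    TwoLonely : Set
    TwoLonely = ∃[ a ] ∃[ a′ ] (a ≢ a′ × Lonely a × Lonely a′)

    TwoInnerBlocks : Set
    TwoInnerBlocks = ∃[ c ] ∃[ d ] ∃[ c′ ] ∃[ d′ ] (InnerPair c d × InnerPair c′ d′ × H c ≢ H c′)

    two-lonely? : Dec TwoLonely
    two-lonely? = any? λ a → any? λ a′ → ¬? (a ≟ a′) ×-dec lonely? a ×-dec lonely? a′

    two-inner-blocks? : Dec TwoInnerBlocks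
    two-inner-blocks? = any? λ c → any? λ d → any? λ c′ → any? λ d′ →
      inner-pair? c d ×-dec inner-pair? c′ d′ ×-dec ¬? (H c ≟ H c′)

    lonely-if-no-inner-pair : ∀ {c} → (∀ d → ¬ InnerPair d c) → Lonely c
    lonely-if-no-inner-pair {c} no-pair d Hd≡Hc with d ≟ c
    ... | yes d≡c = d≡c
    ... | no d≢c = ⊥-elim (no-pair d (d≢c , Hd≡Hc))

    module OneBlock (¬two-lonely : ¬ TwoLonely) (¬two-blocks : ¬ TwoInnerBlocks)
                    {p p′ : Fin k} (pp′ : InnerPair p p′) where

      inner-in-p : ∀ c d → InnerPair c d → H c ≡ H p
      inner-in-p c d cd with H c ≟ H p
      ... | yes Hc≡Hp = Hc≡Hp
      ... | no Hc≢Hp = ⊥-elim (¬two-blocks (c , d , p , p′ , cd , pp′ , Hc≢Hp))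

      outside-lonely : ∀ {s} → H s ≢ H p → Lonely s
      outside-lonely Hs≢Hp = lonely-if-no-inner-pair λ d (d≢s , Hd≡Hs) →
        Hs≢Hp (trans (sym Hd≡Hs) (inner-in-p d _ (d≢s , Hd≡Hs)))

      all-in-p : (∀ s → ¬ H s ≢ H p) → ∀ c → H c ≡ H p
      all-in-p ∄outside c with H c ≟ H p
      ... | yes Hc≡Hp = Hc≡Hp
      ... | no Hc≢Hp = ⊥-elim (∄outside c Hc≢Hp)

      others-in-p : ∀ {s} → H s ≢ H p → ∀ c → c ≢ s → H c ≡ H p
      others-in-p Hs≢Hp c c≢s with H c ≟ H p
      ... | yes Hc≡Hp = Hc≡Hp
      ... | no Hc≢Hp = ⊥-elim (¬two-lonely (c , _ , c≢s , outside-lonely Hc≢Hp , outside-lonely Hs≢Hp))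

  module _ {j t} (H : Fin (2 + j) → Fin b) (T : Fin (2 + j) → Point t)
           (injective : ∀ {c d} → H c ≡ H d → T c ≡ T d → c ≡ d) where
    open Split H T injective

    one-block : ¬ TwoLonely → ¬ TwoInnerBlocks → ∀ {p p′} → InnerPair p p′ →
                UniqueEdgeProperty (2 + j) t → UniqueEdgeProperty (1 + j) t → HasUniquelyColouredEdge Q
    one-block ¬two-lonely ¬two-blocks {p} pp′ unique unique′ =
      by-outsider (any? λ s → ¬? (H s ≟ H p))
      where
        open OneBlock ¬two-lonely ¬two-blocks pp′
        by-outsider : Dec (∃[ s ] H s ≢ H p) → HasUniquelyColouredEdge Q
        by-outsider (no ∄outside) =
          block-edge id id (all-in-p λ s Hs≢Hp → ∄outside (s , Hs≢Hp)) (λ c _ → c , refl) inner-in-p unique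
        by-outsider (yes (s , Hs≢Hp)) =
          block-edge (punchIn s) (punchIn-injective s _ _)
            (λ i → others-in-p Hs≢Hp (punchIn s i) (punchInᵢ≢i s i))
            (λ c Hc≡Hp → let s≢c = λ s≡c → Hs≢Hp (trans (cong H s≡c) Hc≡Hp)
                         in punchOut s≢c , punchIn-punchOut s≢c)
            inner-in-p unique′

    unique-edge-split : 2 + j ≤ 5 → UniqueEdgeProperty (2 + j) t → UniqueEdgeProperty (1 + j) t →
                        HasUniquelyColouredEdge Q
    unique-edge-split k≤5 unique unique′ with two-lonely?
    ... | yes (a , a′ , a≢a′ , a-lonely , a′-lonely) = a , a′ , lonely-edge a≢a′ a-lonely a′-lonely
    ... | no ¬two-lonely with two-inner-blocks?
    ...   | yes (_ , _ , _ , _ , cd , c′d′ , Hc≢Hc′) = two-blocks k≤5 cd c′d′ Hc≢Hc′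
    ...   | no ¬two-blocks with any? (λ c → any? (inner-pair? c))
    ...     | yes (_ , _ , pp′) = one-block ¬two-lonely ¬two-blocks pp′ unique unique′
    ...     | no ∄inner = ⊥-elim (¬two-lonely (zero , suc zero , 0≢1+n , alone , alone))
      where
        alone : ∀ {c} → Lonely c
        alone = lonely-if-no-inner-pair λ d dc → ∄inner (d , _ , dc)

  UniquelyColoured-cong : ∀ {k t} {P P′ : Fin k → Point t} → (∀ c → P c ≡ P′ c) →
                          ∀ {a b} → UniquelyColoured P a b → UniquelyColoured P′ a b
  UniquelyColoured-cong {P = P} {P′} P≗P′ {a} {b} (a≢b , unique) = a≢b , λ c d c≢d e →
    unique c d c≢d (trans (cong₂ colour (P≗P′ c) (P≗P′ d))
                          (trans e (sym (cong₂ colour (P≗P′ a) (P≗P′ b)))))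

  unique-edge-of-two : ∀ {t} → UniqueEdgeProperty 2 t
  unique-edge-of-two P _ = zero , suc zero , 0≢1+n , λ where
    zero zero c≢d _ → ⊥-elim (c≢d refl)
    zero (suc zero) _ _ → inj₁ (refl , refl)
    (suc zero) zero _ _ → inj₂ (refl , refl)
    (suc zero) (suc zero) c≢d _ → ⊥-elim (c≢d refl)

  unique-edge : ∀ j t → 2 + j ≤ 5 → UniqueEdgeProperty (2 + j) t
  unique-edge zero t _ = unique-edge-of-two
  unique-edge (suc j) zero _ P P-injective = ⊥-elim (0≢1+n (P-injective (empty (P zero) (P (suc zero)))))
    where
      empty : (u v : Point 0) → u ≡ v
      empty [] [] = refl
  unique-edge (suc j) (suc t) k≤5 P P-injective =
    let a , a′ , coloured = unique-edge-split H T injective k≤5 (unique-edge (suc j) t k≤5)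
                              (unique-edge j t (ℕ.≤-trans (ℕ.n≤1+n _) k≤5))
    in a , a′ , UniquelyColoured-cong (λ c → head∷tail (P c)) coloured
    where
      H = λ c → head (P c)
      T = λ c → tail (P c)
      head∷tail : ∀ {t} (u : Point (suc t)) → head u ∷ tail u ≡ u
      head∷tail (_ ∷ _) = refl
      injective : ∀ {c d} → H c ≡ H d → T c ≡ T d → c ≡ d
      injective {c} {d} Hc≡Hd Tc≡Td =
        P-injective (trans (sym (head∷tail (P c))) (trans (cong₂ _∷_ Hc≡Hd Tc≡Td) (head∷tail (P d))))

signCode : Sign → Fin 3
signCode lt = zero
signCode eq = suc zero
signCode gt = suc (suc zero)

signCode-injective : ∀ {s s′} → signCode s ≡ signCode s′ → s ≡ s′
signCode-injective {lt} {lt} _ = refl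
signCode-injective {eq} {eq} _ = refl
signCode-injective {gt} {gt} _ = refl

encodeSigns : ∀ {t} → Vec Sign t → Fin (3 ^ t)
encodeSigns [] = zero
encodeSigns (s ∷ ss) = combine (signCode s) (encodeSigns ss)

encodeSigns-injective : ∀ {t} (ss ss′ : Vec Sign t) → encodeSigns ss ≡ encodeSigns ss′ → ss ≡ ss′
encodeSigns-injective [] [] _ = refl
encodeSigns-injective (s ∷ ss) (s′ ∷ ss′) e =
  let s≡s′ , ss≡ss′ = combine-injective (signCode s) (encodeSigns ss) (signCode s′) (encodeSigns ss′) e
  in cong₂ _∷_ (signCode-injective s≡s′) (encodeSigns-injective ss ss′ ss≡ss′)

module Encoding (b : ℕ) where
  open Construction b

  colours : ℕ → ℕ
  colours zero = 1
  colours (suc t) = b * b * 3 ^ t + colours t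

  encode : ∀ {t} → Colour t → Fin (colours t)
  encode identical = zero
  encode {suc t} (here x y s) = combine (combine x y) (encodeSigns s) ↑ˡ colours t
  encode {suc t} (there c) = (b * b * 3 ^ t) ↑ʳ encode c

  ↑ˡ≢↑ʳ : ∀ {m n} (i : Fin m) (j : Fin n) → i ↑ˡ n ≢ m ↑ʳ j
  ↑ˡ≢↑ʳ {m} {n} i j e
    with () ← trans (sym (splitAt-↑ˡ m i n)) (trans (cong (splitAt m) e) (splitAt-↑ʳ m n j))

  encode-injective : ∀ {t} (c c′ : Colour t) → encode c ≡ encode c′ → c ≡ c′
  encode-injective identical identical _ = refl
  encode-injective {suc t} (here x y s) (here x′ y′ s′) e
    with xy≡x′y′ , s≡s′ ← combine-injective _ _ _ _ (↑ˡ-injective (colours t) _ _ e)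
    with refl , refl ← combine-injective x y x′ y′ xy≡x′y′
    = cong (here x y) (encodeSigns-injective s s′ s≡s′)
  encode-injective (here _ _ _) (there _) e = ⊥-elim (↑ˡ≢↑ʳ _ _ e)
  encode-injective (there _) (here _ _ _) e = ⊥-elim (↑ˡ≢↑ʳ _ _ (sym e))
  encode-injective {suc t} (there c) (there c′) e =
    cong there (encode-injective c c′ (↑ʳ-injective (b * b * 3 ^ t) _ _ e))

  colours-≤ : 1 ≤ b → ∀ t → colours t ≤ b * b * 3 ^ t
  colours-≤ 1≤b zero = ℕ.*-mono-≤ (ℕ.*-mono-≤ 1≤b 1≤b) ℕ.≤-refl
  colours-≤ 1≤b (suc t) = begin
    b * b * 3 ^ t + colours t           ≤⟨ ℕ.+-monoʳ-≤ (b * b * 3 ^ t) (colours-≤ 1≤b t) ⟩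
    b * b * 3 ^ t + b * b * 3 ^ t       ≤⟨ ℕ.m≤m+n _ (b * b * 3 ^ t) ⟩
    b * b * 3 ^ t + b * b * 3 ^ t + b * b * 3 ^ t ≡⟨ triple (b * b) (3 ^ t) ⟩
    b * b * 3 ^ suc t                   ∎
    where
      open ℕ.≤-Reasoning
      triple : ∀ x y → x * y + x * y + x * y ≡ x * (3 * y)
      triple = solve 2 (λ x y → x :* y :+ x :* y :+ x :* y := x :* (con 3 :* y)) refl

  digits : ∀ {t} → Fin (b ^ t) → Point t
  digits {zero} _ = []
  digits {suc t} i = let d , i′ = remQuot {b} (b ^ t) i in d ∷ digits i′

  digits-injective : ∀ {t} (i j : Fin (b ^ t)) → digits {t} i ≡ digits j → i ≡ j
  digits-injective {zero} zero zero _ = refl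
  digits-injective {suc t} i j e = begin
    i                                                        ≡⟨ combine-remQuot {b} (b ^ t) i ⟨
    combine (proj₁ (remQuot {b} (b ^ t) i)) (proj₂ (remQuot {b} (b ^ t) i))
      ≡⟨ cong₂ combine (∷-injectiveˡ e) (digits-injective _ _ (∷-injectiveʳ e)) ⟩
    combine (proj₁ (remQuot {b} (b ^ t) j)) (proj₂ (remQuot {b} (b ^ t) j)) ≡⟨ combine-remQuot {b} (b ^ t) j ⟩
    j                                                        ∎
    where open ≡-Reasoning

SameEdge? : ∀ {k} (c d a b : Fin k) → Dec (SameEdge c d a b)
SameEdge? c d a b = ((c ≟ a) ×-dec (d ≟ b)) ⊎-dec ((c ≟ b) ×-dec (d ≟ a))

edges5-SameEdge : ∀ a b → a ≢ b → length (filter (λ p → SameEdge? (proj₁ p) (proj₂ p) a b) edges5) ≡ 1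
edges5-SameEdge = from-yes (all? λ a → all? λ b → ¬? (a ≟ b) →-dec
  (length (filter (λ p → SameEdge? (proj₁ p) (proj₂ p) a b) edges5) ℕ.≟ 1))

lone-edge⇒odd-colour-class : ∀ {n m} {c : Colouring n m} → Symmetric c → (f : Fin 5 → Fin n) →
                              ∀ {a b} → a ≢ b →
                              (∀ p q → c (f p) (f q) ≡ c (f a) (f b) → SameEdge p q a b) →
                              HasOddColourClass c f
lone-edge⇒odd-colour-class {c = c} c-sym f {a} {b} a≢b lone = c (f a) (f b) , cong (_% 2) (begin
  length (filter (λ p → c (f (proj₁ p)) (f (proj₂ p)) ≟ c (f a) (f b)) edges5)
    ≡⟨ cong length (filter-≐ (λ p → c (f (proj₁ p)) (f (proj₂ p)) ≟ c (f a) (f b))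
                             (λ p → SameEdge? (proj₁ p) (proj₂ p) a b)
                             ((λ {p} → lone (proj₁ p) (proj₂ p)) , λ {p} → same-colour p) edges5) ⟩
  length (filter (λ p → SameEdge? (proj₁ p) (proj₂ p) a b) edges5)
    ≡⟨ edges5-SameEdge a b a≢b ⟩
  1 ∎)
  where
    open ≡-Reasoning
    same-colour : ∀ p → SameEdge (proj₁ p) (proj₂ p) a b → c (f (proj₁ p)) (f (proj₂ p)) ≡ c (f a) (f b)
    same-colour _ (inj₁ (refl , refl)) = refl
    same-colour _ (inj₂ (refl , refl)) = c-sym (f b) (f a)

k5-colouring : ∀ {b t n} → n ≤ b ^ t → ∃[ c ] (Symmetric {n} {Encoding.colours b t} c × K5Good c)
k5-colouring {b} {t} {n} n≤b^t = col , col-sym , good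
  where
    open Construction b
    open Encoding b

    point : Fin n → Point t
    point i = digits (inject≤ i n≤b^t)

    point-injective : Injective _≡_ _≡_ point
    point-injective e = inject≤-injective _ _ _ _ (digits-injective _ _ e)

    col : Colouring n (colours t)
    col i j = encode (colour (point i) (point j))

    col-sym : Symmetric col
    col-sym i j = cong encode (colour-sym (point i) (point j))

    good : K5Good col
    good f f-injective with unique-edge 3 t ℕ.≤-refl (point ∘ f) (f-injective ∘ point-injective)
    ... | a , a′ , a≢a′ , unique =
      lone-edge⇒odd-colour-class col-sym f a≢a′ λ p q e → lone p q (encode-injective _ _ e)
      where
        P = point ∘ f
        lone : ∀ p q → colour (P p) (P q) ≡ colour (P a) (P a′) → SameEdge p q a a′
        lone p q e with p ≟ q
        ... | yes refl = ⊥-elim (a≢a′ (f-injective (point-injective (colour-self (P p) (P a) (P a′) e))))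
        ... | no p≢q = unique p q p≢q e

floor-log : ∀ b → 1 < b → ∀ n → ∃[ t ] (b ^ t ≤ suc n × suc n < b ^ suc t)
floor-log b 1<b zero = 0 , ℕ.≤-refl , subst (1 <_) (sym (ℕ.*-identityʳ b)) 1<b
floor-log b 1<b (suc n) with floor-log b 1<b n
... | t , lower , upper with suc (suc n) ℕ.<? b ^ suc t
...   | yes below = t , ℕ.m≤n⇒m≤1+n lower , below
...   | no ¬below = suc t , ℕ.≤-reflexive (sym power) , subst (_< b ^ suc (suc t)) (sym power)
                                                        (ℕ.^-monoʳ-< b 1<b (ℕ.n<1+n (suc t)))
  where power = ℕ.≤-antisym upper (ℕ.≮⇒≥ ¬below)

^-cancelʳ-< : ∀ m .{{_ : NonZero m}} {i j} → m ^ i < m ^ j → i < j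
^-cancelʳ-< m {i} {j} m^i<m^j with i ℕ.<? j
... | yes i<j = i<j
... | no i≮j = ⊥-elim (ℕ.<⇒≱ m^i<m^j (ℕ.^-monoʳ-≤ m (ℕ.≮⇒≥ i≮j)))

-- With b = 3^c and c = 2K, words of length t + 1 get at most b² 3^(t+1) = 3^(2c+t+1) colours,
-- and (2c + t + 1) K ≤ c t once t > 2c.
module Parameters (k : ℕ) where

  K c b : ℕ
  K = suc k
  c = K + K
  b = 3 ^ c

  instance
    b≢0 : NonZero b
    b≢0 = ℕ.m^n≢0 3 c

  1<b : 1 < b
  1<b = ℕ.^-monoʳ-< 3 (s≤s (s≤s z≤n)) {0} {c} (s≤s z≤n)

  exponent-bound : ∀ t → suc (c + c) ≤ t → (c + c + suc t) * K ≤ c * t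
  exponent-bound t 2c<t = begin
    (c + c + suc t) * K    ≡⟨ split c t K ⟩
    suc (c + c) * K + t * K ≤⟨ ℕ.+-monoˡ-≤ (t * K) (ℕ.*-monoˡ-≤ K 2c<t) ⟩
    t * K + t * K          ≡⟨ double K t ⟨
    c * t                  ∎
    where
      open ℕ.≤-Reasoning
      split : ∀ c t K → (c + c + suc t) * K ≡ suc (c + c) * K + t * K
      split = solve 3 (λ c t K → (c :+ c :+ (con 1 :+ t)) :* K := (con 1 :+ c :+ c) :* K :+ t :* K) refl
      double : ∀ K t → (K + K) * t ≡ t * K + t * K
      double = solve 2 (λ K t → (K :+ K) :* t := t :* K :+ t :* K) refl

  colours-bound : ∀ t → suc (c + c) ≤ t → Encoding.colours b (suc t) ^ K ≤ b ^ t
  colours-bound t 2c<t = begin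
    colours (suc t) ^ K        ≤⟨ ℕ.^-monoˡ-≤ K (colours-≤ (ℕ.m^n>0 3 c) (suc t)) ⟩
    (b * b * 3 ^ suc t) ^ K    ≡⟨ cong (_^ K) b*b*3^t+1≡ ⟩
    (3 ^ (c + c + suc t)) ^ K  ≡⟨ ℕ.^-*-assoc 3 (c + c + suc t) K ⟩
    3 ^ ((c + c + suc t) * K)  ≤⟨ ℕ.^-monoʳ-≤ 3 (exponent-bound t 2c<t) ⟩
    3 ^ (c * t)                ≡⟨ ℕ.^-*-assoc 3 c t ⟨
    b ^ t                      ∎
    where
      open ℕ.≤-Reasoning
      open Encoding b
      b*b*3^t+1≡ : b * b * 3 ^ suc t ≡ 3 ^ (c + c + suc t)
      b*b*3^t+1≡ = sym (trans (ℕ.^-distribˡ-+-* 3 (c + c) (suc t))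
                              (cong (_* 3 ^ suc t) (ℕ.^-distribˡ-+-* 3 c c)))

theorem1 : (k : ℕ) → ∃[ N ] ((n : ℕ) → N ≤ n →
    ∃[ m ] (m ^ suc k ≤ n × ∃[ c ] (Symmetric {n} {m} c × K5Good c)))
theorem1 k = suc (b ^ suc (c + c)) , λ where
    zero ()
    (suc n) (s≤s N≤n) →
      let t , lower , upper = floor-log b 1<b n
          2c<t = ℕ.≤-pred (^-cancelʳ-< b (ℕ.<-trans (s≤s N≤n) upper))
      in Encoding.colours b (suc t)
       , ℕ.≤-trans (colours-bound t 2c<t) lower
       , k5-colouring {b} {suc t} (ℕ.<⇒≤ upper)
  where open Parameters k
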